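{- Let $d,m,k$ be positive integers with $1\le k\le 2m+1$. If there exists a $k$-extended Langford sequence of defect $d$ and length $m$, then the set $[d,d+3m]\cup[-d-3m,-d]\cup\{0\}$ can be partitioned into $3$-element subsets (triples) such that the sum of the three members of each triple is zero.
   Context: For integers $a\le b$, $[a,b]$ denotes $\{a,a+1,\dots,b\}$. A $k$-extended Langford sequence of defect $d$ and length $m$ is a sequence $(l_1,\dots,l_{2m+1})$ in which position $l_k$ is empty and every other term lies in $\{d,d+1,\dots,d+m-1\}$, each $j\in\{d,\dots,d+m-1\}$ occurs exactly twice, and the two occurrences of $j$ are separated by exactly $j-1$ terms (i.e. occupy positions $a$ and $a+j$). Equivalently, it is a partition of $[1,2m+1]\setminus\{k\}$ into pairs $\{a_j,b_j\}$, $j\in[d,d+m-1]$, with $b_j-a_j=j$. -}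

module Defs where

open import Data.Nat using (ℕ; suc; _+_; _*_; _≟_)
open import Data.Integer as ℤ using (ℤ; -_)
open import Data.Fin using (Fin; toℕ)
open import Data.List using (List; []; _∷_; _++_; map; concatMap; filter; upTo; allFin)
open import Data.Product using (Σ; _×_; _,_)
open import Relation.Nullary using (¬?)
open import Relation.Binary.PropositionalEquality using (_≡_)
open import Data.List.Relation.Binary.Permutation.Propositional using (_↭_)

range : ℕ → ℕ → List ℕ
range a c = map (λ i → a + i) (upTo c)

positions : ℕ → ℕ → List ℕ
positions m k = filter (λ p → ¬? (p ≟ k)) (range 1 (suc (2 * m)))

-- A k-extended Langford sequence of defect d and length m:
-- for each j = d + i (i < m) a first position a i; the pairs
-- {a i , a i + j} partition [1, 2m+1] \ {k}, i.e. the list of all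
-- 2m occupied positions is a permutation of [1,2m+1] \ {k}.
ExtLangford : (k d m : ℕ) → Set
ExtLangford k d m =
  Σ (Fin m → ℕ) λ a →
    concatMap (λ i → a i ∷ (a i + (d + toℕ i)) ∷ []) (allFin m) ↭ positions m k

-- The set [d, d+3m] ∪ [-d-3m, -d] ∪ {0} as a list of integers
-- (no repetitions when d ≥ 1).
targetSet : ℕ → ℕ → List ℤ
targetSet d m =
  map ℤ.+_ (range d (suc (3 * m))) ++ map (λ n → - (ℤ.+ n)) (range d (suc (3 * m))) ++ (ℤ.+ 0 ∷ [])

ZeroSumTriplePartition : List ℤ → Set
ZeroSumTriplePartition S =
  Σ (List (ℤ × ℤ × ℤ)) λ ts →
    (∀ x y z → (x , y , z) ∈ ts → x ℤ.+ y ℤ.+ z ≡ ℤ.+ 0) ×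
    (concatMap (λ { (x , y , z) → x ∷ y ∷ z ∷ [] }) ts ↭ S)
  where open import Data.List.Membership.Propositional using (_∈_)

module Submission where

-- Put n = d + m - 1.  If the pair {a_j , a_j + j} occupies two positions of the
-- Langford sequence (j ∈ [d, d+m-1]), then j + (a_j + n) = (a_j + j) + n, so the
-- triples (j , a_j + n , a_j + j + n) are additive triples (x , y , x + y).  Their
-- members are the differences [d, d+m-1] together with the occupied positions
-- shifted by n, i.e. [d+m, d+3m] without the shifted empty position k + n.

open import Defs
open import Data.Nat using (ℕ; zero; suc; _+_; _*_; _≤_; _<_; _≟_; s≤s)
open import Data.Nat.Properties using (+-identityʳ; +-suc; +-comm; +-assoc; ≤-refl; ≤-trans; n≤1+n; <⇒≱; <⇒≢; ≤∧≢⇒<)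
open import Data.Integer as ℤ using (ℤ; -_)
import Data.Integer.Properties as ℤᵖ
open import Data.Fin using (Fin; toℕ)
open import Data.List using (List; []; _∷_; _++_; [_]; map; concatMap; filter; applyUpTo; tabulate; allFin)
open import Data.List.Properties using (++-assoc; map-applyUpTo; map-tabulate; map-++; concatMap-++; filter-reject; filter-accept; filter-all)
open import Data.List.Relation.Unary.All as All using (All)
open import Data.List.Relation.Unary.Any using (here; there)
open import Data.List.Membership.Propositional using (_∈_)
open import Data.List.Membership.Propositional.Properties using (∈-++⁻)
open import Data.List.Relation.Binary.Permutation.Propositional
  using (_↭_; ↭-refl; ↭-reflexive; ↭-sym; ↭-trans; prep; swap; module PermutationReasoning)
open import Data.List.Relation.Binary.Permutation.Propositional.Properties
  using (shift; shifts; ++⁺; ++⁺ˡ; ++-comm; map⁺)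
open import Data.Product using (_×_; _,_)
open import Data.Sum using (inj₁; inj₂)
open import Data.Empty using (⊥-elim)
open import Function using (_∘_)
open import Relation.Nullary using (¬?; yes; no)
open import Relation.Binary.PropositionalEquality using (_≡_; refl; sym; trans; cong; cong₂; subst; module ≡-Reasoning)

interval : ℕ → ℕ → List ℕ
interval a zero    = []
interval a (suc c) = a ∷ interval (suc a) c

applyUpTo-interval : ∀ a c (f : ℕ → ℕ) → (∀ i → f i ≡ a + i) → applyUpTo f c ≡ interval a c
applyUpTo-interval a zero    f f≗a+ = refl
applyUpTo-interval a (suc c) f f≗a+ = cong₂ _∷_
  (trans (f≗a+ 0) (+-identityʳ a))
  (applyUpTo-interval (suc a) c (f ∘ suc) (λ i → trans (f≗a+ (suc i)) (+-suc a i)))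

tabulate-toℕ : ∀ {A : Set} c (f : ℕ → A) → tabulate (f ∘ toℕ {c}) ≡ applyUpTo f c
tabulate-toℕ zero    f = refl
tabulate-toℕ (suc c) f = cong (f 0 ∷_) (tabulate-toℕ c (f ∘ suc))

range-interval : ∀ a c → range a c ≡ interval a c
range-interval a c = trans (map-applyUpTo (λ i → i) (a +_) c) (applyUpTo-interval a c (a +_) (λ _ → refl))

allFin-interval : ∀ a c → map (λ (i : Fin c) → a + toℕ i) (allFin c) ≡ interval a c
allFin-interval a c = begin
  map (λ i → a + toℕ i) (allFin c) ≡⟨ map-tabulate (λ i → i) (λ i → a + toℕ i) ⟩
  tabulate ((a +_) ∘ toℕ)          ≡⟨ tabulate-toℕ c (a +_) ⟩
  applyUpTo (a +_) c               ≡⟨ applyUpTo-interval a c (a +_) (λ _ → refl) ⟩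
  interval a c                     ∎
  where open ≡-Reasoning

interval-shift : ∀ n a c → map (_+ n) (interval a c) ≡ interval (a + n) c
interval-shift n a zero    = refl
interval-shift n a (suc c) = cong (a + n ∷_) (interval-shift n (suc a) c)

interval-++ : ∀ a c e → interval a c ++ interval (a + c) e ≡ interval a (c + e)
interval-++ a zero    e rewrite +-identityʳ a = refl
interval-++ a (suc c) e rewrite +-suc a c     = cong (a ∷_) (interval-++ (suc a) c e)

interval-lower : ∀ a c → All (a ≤_) (interval a c)
interval-lower a zero    = All.[]
interval-lower a (suc c) = ≤-refl All.∷ All.map (≤-trans (n≤1+n a)) (interval-lower (suc a) c)

interval-remove : ∀ k a c → a ≤ k → k < a + c →
  filter (λ p → ¬? (p ≟ k)) (interval a c) ++ [ k ] ↭ interval a c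
interval-remove k a zero    a≤k k<a+0 rewrite +-identityʳ a = ⊥-elim (<⇒≱ k<a+0 a≤k)
interval-remove k a (suc c) a≤k k<a+1+c with a ≟ k
... | yes refl
  rewrite filter-reject (λ p → ¬? (p ≟ a)) {x = a} {xs = interval (suc a) c} (λ a≢a → a≢a refl)
        | filter-all (λ p → ¬? (p ≟ a)) (All.map (λ a<p a≡p → <⇒≢ a<p (sym a≡p)) (interval-lower (suc a) c))
  = ++-comm (interval (suc a) c) [ a ]
... | no a≢k
  rewrite filter-accept (λ p → ¬? (p ≟ k)) {x = a} {xs = interval (suc a) c} a≢k
  = prep a (interval-remove k (suc a) c (≤∧≢⇒< a≤k a≢k) (subst (k <_) (+-suc a c) k<a+1+c))

plusMinus : List ℕ → List ℤ
plusMinus W = map ℤ.+_ W ++ map (λ w → - (ℤ.+ w)) W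

symmetric : List ℕ → List ℤ
symmetric W = map ℤ.+_ W ++ map (λ w → - (ℤ.+ w)) W ++ (ℤ.+ 0 ∷ [])

partition-↭ : ∀ {S S′} → S ↭ S′ → ZeroSumTriplePartition S → ZeroSumTriplePartition S′
partition-↭ S↭S′ (ts , zeroSum , flat↭S) = ts , zeroSum , ↭-trans flat↭S S↭S′

partition-++ : ∀ {S S′} → ZeroSumTriplePartition S → ZeroSumTriplePartition S′ →
  ZeroSumTriplePartition (S ++ S′)
partition-++ (ts , zeroSum , flat↭S) (ts′ , zeroSum′ , flat↭S′) =
  ts ++ ts′ , zeroSum″ , ↭-trans (↭-reflexive (concatMap-++ _ ts ts′)) (++⁺ flat↭S flat↭S′)
  where
  zeroSum″ : ∀ x y z → (x , y , z) ∈ ts ++ ts′ → x ℤ.+ y ℤ.+ z ≡ ℤ.+ 0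
  zeroSum″ x y z t∈ts++ts′ with ∈-++⁻ ts t∈ts++ts′
  ... | inj₁ t∈ts  = zeroSum x y z t∈ts
  ... | inj₂ t∈ts′ = zeroSum′ x y z t∈ts′

symmetric-++ : ∀ U W → symmetric (U ++ W) ↭ plusMinus U ++ symmetric W
symmetric-++ U W = begin
  map ℤ.+_ (U ++ W) ++ map neg (U ++ W) ++ zero′
    ≡⟨ cong₂ (λ P N → P ++ N ++ zero′) (map-++ ℤ.+_ U W) (map-++ neg U W) ⟩
  (pos U ++ pos W) ++ (map neg U ++ map neg W) ++ zero′
    ≡⟨ ++-assoc (pos U) (pos W) _ ⟩
  pos U ++ pos W ++ (map neg U ++ map neg W) ++ zero′
    ≡⟨ cong (λ t → pos U ++ pos W ++ t) (++-assoc (map neg U) (map neg W) zero′) ⟩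
  pos U ++ pos W ++ map neg U ++ map neg W ++ zero′
    ↭⟨ ++⁺ˡ (pos U) (shifts (pos W) (map neg U)) ⟩
  pos U ++ map neg U ++ pos W ++ map neg W ++ zero′
    ≡⟨ ++-assoc (pos U) (map neg U) _ ⟨
  plusMinus U ++ symmetric W ∎
  where
  open PermutationReasoning
  pos : List ℕ → List ℤ
  pos = map (λ w → ℤ.+ w)
  neg : ℕ → ℤ
  neg w = - (ℤ.+ w)
  zero′ : List ℤ
  zero′ = ℤ.+ 0 ∷ []

symmetric-↭ : ∀ {W W′} → W ↭ W′ → symmetric W ↭ symmetric W′
symmetric-↭ W↭W′ = ++⁺ (map⁺ ℤ.+_ W↭W′) (++⁺ (map⁺ (λ w → - (ℤ.+ w)) W↭W′) ↭-refl)

additiveTriple-partition : ∀ x y → ZeroSumTriplePartition (plusMinus (x ∷ y ∷ x + y ∷ []))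
additiveTriple-partition x y =
  (px , py , - ps) ∷ (ps , - px , - py) ∷ [] , zeroSum , flat↭
  where
  px = ℤ.+ x
  py = ℤ.+ y
  ps = ℤ.+ (x + y)
  open ≡-Reasoning
  sum-pos : px ℤ.+ py ℤ.+ - ps ≡ ℤ.+ 0
  sum-pos = begin
    px ℤ.+ py ℤ.+ - ps ≡⟨ cong (ℤ._+ - ps) (ℤᵖ.pos-+ x y) ⟨
    ps ℤ.+ - ps        ≡⟨ ℤᵖ.+-inverseʳ ps ⟩
    ℤ.+ 0              ∎
  sum-neg : ps ℤ.+ - px ℤ.+ - py ≡ ℤ.+ 0
  sum-neg = begin
    ps ℤ.+ - px ℤ.+ - py   ≡⟨ ℤᵖ.+-assoc ps (- px) (- py) ⟩
    ps ℤ.+ (- px ℤ.+ - py) ≡⟨ cong (λ t → ps ℤ.+ t) (ℤᵖ.neg-distrib-+ px py) ⟨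
    ps ℤ.+ - (px ℤ.+ py)   ≡⟨ cong (λ t → ps ℤ.+ - t) (ℤᵖ.pos-+ x y) ⟨
    ps ℤ.+ - ps            ≡⟨ ℤᵖ.+-inverseʳ ps ⟩
    ℤ.+ 0                  ∎
  zeroSum : ∀ a b c → (a , b , c) ∈ (px , py , - ps) ∷ (ps , - px , - py) ∷ [] → a ℤ.+ b ℤ.+ c ≡ ℤ.+ 0
  zeroSum _ _ _ (here refl)         = sum-pos
  zeroSum _ _ _ (there (here refl)) = sum-neg
  -- -s ∷ s ∷ -x ∷ -y  ↭  s ∷ -x ∷ -y ∷ -s
  flat↭ : px ∷ py ∷ - ps ∷ ps ∷ - px ∷ - py ∷ [] ↭ px ∷ py ∷ ps ∷ - px ∷ - py ∷ - ps ∷ []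
  flat↭ = prep px (prep py (↭-trans (swap (- ps) ps ↭-refl)
            (prep ps (↭-sym (shift (- ps) (- px ∷ - py ∷ []) [])))))

centre-partition : ∀ c → ZeroSumTriplePartition (symmetric [ c ])
centre-partition c = (ℤ.+ c , - (ℤ.+ c) , ℤ.+ 0) ∷ [] , zeroSum , ↭-refl
  where
  zeroSum : ∀ a b e → (a , b , e) ∈ (ℤ.+ c , - (ℤ.+ c) , ℤ.+ 0) ∷ [] → a ℤ.+ b ℤ.+ e ≡ ℤ.+ 0
  zeroSum _ _ _ (here refl) = cong (ℤ._+ ℤ.+ 0) (ℤᵖ.+-inverseʳ (ℤ.+ c))

additiveTriples : List (ℕ × ℕ) → List ℕ
additiveTriples []             = []
additiveTriples ((x , y) ∷ ps) = x ∷ y ∷ x + y ∷ additiveTriples ps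

doubling : ∀ c ps → ZeroSumTriplePartition (symmetric (additiveTriples ps ++ [ c ]))
doubling c []             = centre-partition c
doubling c ((x , y) ∷ ps) =
  partition-↭ (↭-sym (symmetric-++ (x ∷ y ∷ x + y ∷ []) (additiveTriples ps ++ [ c ])))
    (partition-++ (additiveTriple-partition x y) (doubling c ps))

pairPositions : {I : Set} → (I → ℕ) → (I → ℕ) → List I → List ℕ
pairPositions j a = concatMap (λ i → a i ∷ a i + j i ∷ [])

langford-triples : {I : Set} (j a : I → ℕ) (n k : ℕ) (xs : List I) →
  additiveTriples (map (λ i → j i , a i + n) xs) ++ [ k + n ]
    ↭ map j xs ++ map (_+ n) (pairPositions j a xs ++ [ k ])
langford-triples j a n k []       = ↭-refl
langford-triples j a n k (i ∷ xs) = prep (j i) (begin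
  a i + n ∷ j i + (a i + n) ∷ triples ++ [ k + n ]
    ≡⟨ cong (λ t → a i + n ∷ t ∷ triples ++ [ k + n ]) (second-shifted (j i) (a i)) ⟩
  a i + n ∷ a i + j i + n ∷ triples ++ [ k + n ]
    ↭⟨ prep (a i + n) (prep (a i + j i + n) (langford-triples j a n k xs)) ⟩
  a i + n ∷ a i + j i + n ∷ map j xs ++ shifted
    ↭⟨ shifts (map j xs) (a i + n ∷ a i + j i + n ∷ []) ⟨
  map j xs ++ a i + n ∷ a i + j i + n ∷ shifted ∎)
  where
  open PermutationReasoning
  triples = additiveTriples (map (λ i → j i , a i + n) xs)
  shifted = map (_+ n) (pairPositions j a xs ++ [ k ])
  second-shifted : ∀ j a → j + (a + n) ≡ a + j + n
  second-shifted j a = trans (sym (+-assoc j a n)) (cong (_+ n) (+-comm j a))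

langford-cover : ∀ k d m′ (a : Fin (suc m′) → ℕ) → 1 ≤ k → k ≤ suc (2 * suc m′) →
  pairPositions (λ i → d + toℕ i) a (allFin (suc m′)) ↭ positions (suc m′) k →
  additiveTriples (map (λ i → d + toℕ i , a i + (d + m′)) (allFin (suc m′))) ++ [ k + (d + m′) ]
    ↭ range d (suc (3 * suc m′))
langford-cover k d m′ a 1≤k k≤2m+1 pairs↭positions = begin
  additiveTriples (map (λ i → j i , a i + n) (allFin m)) ++ [ k + n ]
    ↭⟨ langford-triples j a n k (allFin m) ⟩
  map j (allFin m) ++ map (_+ n) (pairPositions j a (allFin m) ++ [ k ])
    ↭⟨ ++⁺ (↭-reflexive (allFin-interval d m)) (map⁺ (_+ n) occupied) ⟩
  interval d m ++ map (_+ n) (interval 1 (suc (2 * m)))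
    ≡⟨ cong (interval d m ++_) (interval-shift n 1 (suc (2 * m))) ⟩
  interval d m ++ interval (suc n) (suc (2 * m))
    ≡⟨ cong (λ b → interval d m ++ interval b (suc (2 * m))) (+-suc d m′) ⟨
  interval d m ++ interval (d + m) (suc (2 * m))
    ≡⟨ interval-++ d m (suc (2 * m)) ⟩
  interval d (m + suc (2 * m))
    ≡⟨ cong (interval d) (+-suc m (2 * m)) ⟩
  interval d (suc (3 * m))
    ≡⟨ range-interval d (suc (3 * m)) ⟨
  range d (suc (3 * m)) ∎
  where
  open PermutationReasoning
  m = suc m′
  n = d + m′
  j : Fin m → ℕ
  j i = d + toℕ i
  occupied : pairPositions j a (allFin m) ++ [ k ] ↭ interval 1 (suc (2 * m))
  occupied = ↭-trans
    (++⁺ (↭-trans pairs↭positions (↭-reflexive (cong (filter (λ p → ¬? (p ≟ k))) (range-interval 1 (suc (2 * m)))))) ↭-refl)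
    (interval-remove k 1 (suc (2 * m)) 1≤k (s≤s k≤2m+1))

lemma2p1 : (d m k : ℕ) → 1 ≤ d → 1 ≤ m → 1 ≤ k → k ≤ suc (2 * m) →
    ExtLangford k d m → ZeroSumTriplePartition (targetSet d m)
lemma2p1 d (suc m′) k _ (s≤s _) 1≤k k≤2m+1 (a , pairs↭positions) =
  partition-↭ (symmetric-↭ (langford-cover k d m′ a 1≤k k≤2m+1 pairs↭positions))
    (doubling (k + (d + m′)) (map (λ i → d + toℕ i , a i + (d + m′)) (allFin (suc m′))))
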